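{- Let $G$ and $H$ be two graphs on the same labeled vertex set $V$ such that every vertex $v \in V$ has the same vertex type in $G$ as in $H$. Then $G$ can be obtained from $H$ by a finite sequence of restricted switches.
   Context: All graphs are finite and simple. For a vertex $v$ of degree $r$ whose neighbours have degrees $x_1 \geq \cdots \geq x_r$, its vertex type is $(x_1,\ldots,x_r)$. A switch in a graph replaces two edges $v_0w_0, v_1w_1$ (with $v_0w_1$ and $v_1w_0$ not edges) by the edges $v_0w_1, v_1w_0$. A restricted switch (or $(d,d')$-switch) is a switch in which $v_0$ and $v_1$ both have degree $d$ and $w_0$ and $w_1$ both have degree $d'$ in the current graph ($d = d'$ is allowed). -}

module Defs where

open import Data.Bool using (Bool; true; false; if_then_else_; _∧_; _∨_)
open import Data.Nat using (ℕ; zero; suc; _+_)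
open import Data.Nat.Properties using (≤-decTotalOrder)
open import Data.Fin using (Fin; _≟_)
open import Data.List using (List; map; filterᵇ; allFin)
open import Data.Nat.ListAction using (sum)
open import Relation.Nullary using (¬_)
open import Relation.Nullary.Decidable using (⌊_⌋)
open import Relation.Binary.PropositionalEquality using (_≡_; _≢_)
open import Data.Product using (Σ; _×_; ∃-syntax)
import Relation.Binary.Construct.Flip.EqAndOrd as Flip
import Data.List.Sort.MergeSort as MS
open import Data.List.Sort.Base using (SortingAlgorithm)

record Graph (n : ℕ) : Set where
  field
    adj   : Fin n → Fin n → Bool
    sym   : ∀ x y → adj x y ≡ adj y x
    irrefl : ∀ x → adj x x ≡ false
open Graph public

deg : ∀ {n} → Graph n → Fin n → ℕ
deg G v = sum (map (λ y → if adj G v y then 1 else 0) (allFin _))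

neighbours : ∀ {n} → Graph n → Fin n → List (Fin n)
neighbours G v = filterᵇ (adj G v) (allFin _)

sortDesc : List ℕ → List ℕ
sortDesc = SortingAlgorithm.sort (MS.mergeSort (Flip.decTotalOrder ≤-decTotalOrder))

vertexType : ∀ {n} → Graph n → Fin n → List ℕ
vertexType G v = sortDesc (map (deg G) (neighbours G v))

samePair : ∀ {n} → Fin n → Fin n → Fin n → Fin n → Bool
samePair a b x y = (⌊ x ≟ a ⌋ ∧ ⌊ y ≟ b ⌋) ∨ (⌊ x ≟ b ⌋ ∧ ⌊ y ≟ a ⌋)

switchedAdj : ∀ {n} → Graph n → (v0 w0 v1 w1 : Fin n) → Fin n → Fin n → Bool
switchedAdj G v0 w0 v1 w1 x y =
  if samePair v0 w1 x y ∨ samePair v1 w0 x y then true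
  else if samePair v0 w0 x y ∨ samePair v1 w1 x y then false
  else adj G x y

record RestrictedSwitch {n : ℕ} (G G' : Graph n) : Set where
  field
    v0 w0 v1 w1 : Fin n
    v0≢w1 : v0 ≢ w1
    v1≢w0 : v1 ≢ w0
    e0  : adj G v0 w0 ≡ true
    e1  : adj G v1 w1 ≡ true
    ne0 : adj G v0 w1 ≡ false
    ne1 : adj G v1 w0 ≡ false
    degv : deg G v0 ≡ deg G v1
    degw : deg G w0 ≡ deg G w1
    result : ∀ x y → adj G' x y ≡ switchedAdj G v0 w0 v1 w1 x y

data Reachable {n : ℕ} : Graph n → Graph n → Set where
  done : ∀ {H G} → (∀ x y → adj H x y ≡ adj G x y) → Reachable H G
  step : ∀ {H H' G} → RestrictedSwitch H H' → Reachable H' G → Reachable H G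

-- A vertex type records the degree of a vertex and, for every c, how many of its neighbours
-- have degree c. A restricted switch preserves both, since at each of its four vertices it trades
-- a neighbour for another one of the same degree. So it suffices to bring H and G closer, in the
-- number of vertex pairs on which they disagree, by restricted switches of either graph: the
-- inverse of a restricted switch is again one.
-- If x has a G-only neighbour of degree c, equal class counts give an H-only neighbour a of x of
-- degree c, and then a G-only neighbour b of a with deg b = deg x. A G-only neighbour z ≠ b of x
-- of degree c that is not a G-only neighbour of b closes a restricted switch in H or in G. If there
-- is none, b has more G-only neighbours of degree c than x, and the path continues from b; this
-- can happen at most n times.

module Submission where

open import Defs hiding (sym)

open import Algebra.Bundles using (CommutativeMonoid)
open import Data.Bool using (Bool; true; false; T; if_then_else_; _∧_; _∨_; not; _xor_)
open import Data.Bool.Properties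
  using (∧-comm; ∨-comm; xor-comm; ∧-zeroʳ; ∧-identityʳ; ∧-commutativeMonoid; ¬-not; T-≡; T-∧; T-∨)
  renaming (_≟_ to _≟ᵇ_)
open import Data.Fin using (Fin; zero; suc; _≟_)
open import Data.Fin.Properties using (any?)
open import Data.List using (List; []; _∷_; map; filterᵇ; allFin; length; tabulate)
open import Data.List.Properties using (map-cong; map-∘; length-map; map-tabulate)
open import Data.List.Relation.Binary.Permutation.Propositional using (_↭_)
open import Data.List.Relation.Binary.Permutation.Propositional.Properties using (map⁺; ↭-length)
open import Data.List.Sort.Base using (SortingAlgorithm)
import Data.List.Sort.MergeSort as MergeSort
open import Data.Nat using (ℕ; zero; suc; _+_; _∸_; _≤_; _<_; _≡ᵇ_; z≤n; s≤s)
open import Data.Nat.Induction using (<-wellFounded)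
import Data.Nat.ListAction as List
open import Data.Nat.ListAction.Properties using (sum-↭)
open import Data.Nat.Properties
  using ( +-assoc; +-comm; +-identityʳ; +-cancelˡ-≡; +-mono-≤; +-mono-<-≤; +-mono-≤-<; m≤m+n; m≤n+m
        ; m+n≡0⇒m≡0; m+n≡0⇒n≡0; ≤-reflexive; ≤-trans; <⇒≤; <-≤-trans; ∸-monoʳ-<; n≢0⇒n>0; ≡ᵇ⇒≡; ≡⇒≡ᵇ
        ; ≤-decTotalOrder; +-0-commutativeMonoid; +-commutativeSemigroup; module ≤-Reasoning )
import Data.Nat.Properties as ℕ
open import Algebra.Properties.CommutativeMonoid.Sum +-0-commutativeMonoid using (sum; sum-cong-≗; ∑-distrib-+)
open import Algebra.Properties.CommutativeSemigroup +-commutativeSemigroup using (x∙yz≈y∙xz)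
open import Algebra.Properties.CommutativeSemigroup (CommutativeMonoid.commutativeSemigroup ∧-commutativeMonoid)
  using (xy∙z≈xz∙y)
open import Data.Product as Product using (Σ; _×_; _,_; proj₁; proj₂; ∃-syntax; ∃₂)
open import Data.Sum as Sum using (_⊎_; inj₁; inj₂)
open import Function using (_∘_; id)
open import Function.Bundles using (Equivalence)
open import Induction.WellFounded using (Acc; acc)
open import Relation.Nullary using (¬_; Dec; does; yes; no; contradiction)
open import Relation.Nullary.Decidable using (⌊_⌋; toWitness; _×-dec_; ¬?)
import Relation.Binary.Construct.Flip.EqAndOrd as Flip
open import Relation.Binary.PropositionalEquality

private variable
  A : Set
  n : ℕ
  R S : Fin n → ℕ
  f g : Fin n → Bool
  p q u a b x y : Fin n

-- Finite sums and counting

sum-mono-≤ : (∀ u → R u ≤ S u) → sum R ≤ sum S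
sum-mono-≤ {zero}  R≤S = z≤n
sum-mono-≤ {suc n} R≤S = +-mono-≤ (R≤S zero) (sum-mono-≤ (R≤S ∘ suc))

sum-mono-< : (∀ u → R u ≤ S u) → ∀ p → R p < S p → sum R < sum S
sum-mono-< R≤S zero    Rp<Sp = +-mono-<-≤ Rp<Sp (sum-mono-≤ (R≤S ∘ suc))
sum-mono-< R≤S (suc p) Rp<Sp = +-mono-≤-< (R≤S zero) (sum-mono-< (R≤S ∘ suc) p Rp<Sp)

sum≡0⇒≡0 : (R : Fin n → ℕ) → sum R ≡ 0 → ∀ u → R u ≡ 0
sum≡0⇒≡0 R R≡0 zero    = m+n≡0⇒m≡0 (R zero) R≡0
sum≡0⇒≡0 R R≡0 (suc u) = sum≡0⇒≡0 (R ∘ suc) (m+n≡0⇒n≡0 (R zero) R≡0) u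

sum>0⇒>0 : (R : Fin n → ℕ) → 0 < sum R → ∃[ u ] 0 < R u
sum>0⇒>0 {suc n} R R>0 with R zero in R₀
... | suc _ = zero , subst (0 <_) (sym R₀) (s≤s z≤n)
... | zero  with sum>0⇒>0 (R ∘ suc) R>0
...   | u , Ru>0 = suc u , Ru>0

sum-tabulate : (R : Fin n → ℕ) → List.sum (tabulate R) ≡ sum R
sum-tabulate {zero}  R = refl
sum-tabulate {suc n} R = cong (R zero +_) (sum-tabulate (R ∘ suc))

toℕ : Bool → ℕ
toℕ b = if b then 1 else 0

toℕ≤1 : ∀ b → toℕ b ≤ 1
toℕ≤1 false = z≤n
toℕ≤1 true  = s≤s z≤n

toℕ-mono : ∀ {b c} → (b ≡ true → c ≡ true) → toℕ b ≤ toℕ c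
toℕ-mono {false} b⇒c = z≤n
toℕ-mono {true}  b⇒c rewrite b⇒c refl = s≤s z≤n

toℕ-split : ∀ b c → toℕ b ≡ toℕ (b ∧ c) + toℕ (b ∧ not c)
toℕ-split false c     = refl
toℕ-split true  false = refl
toℕ-split true  true  = refl

infix  4 _⊆_
infixl 6 _─_

count : (Fin n → Bool) → ℕ
count f = sum (toℕ ∘ f)

_⊆_ : (Fin n → Bool) → (Fin n → Bool) → Set
f ⊆ g = ∀ u → f u ≡ true → g u ≡ true

_─_ : (Fin n → Bool) → Fin n → Fin n → Bool
(f ─ p) u = if does (u ≟ p) then false else f u

─-other : (f : Fin n → Bool) → u ≢ p → (f ─ p) u ≡ f u
─-other {u = u} {p = p} f u≢p with u ≟ p
... | yes u≡p = contradiction u≡p u≢p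
... | no _    = refl

count-cong : f ≗ g → count f ≡ count g
count-cong f≗g = sum-cong-≗ (cong toℕ ∘ f≗g)

count-⊂ : f ⊆ g → ∀ a → f a ≡ false → g a ≡ true → count f < count g
count-⊂ {f = f} {g = g} f⊆g a fa ga = sum-mono-< (λ u → toℕ-mono (f⊆g u)) a fa<ga
  where
  fa<ga : toℕ (f a) < toℕ (g a)
  fa<ga rewrite fa | ga = s≤s z≤n

count-split : (f g : Fin n → Bool) → count f ≡ count (λ u → f u ∧ g u) + count (λ u → f u ∧ not (g u))
count-split f g = trans (sum-cong-≗ (λ u → toℕ-split (f u) (g u)))
                        (∑-distrib-+ (λ u → toℕ (f u ∧ g u)) (λ u → toℕ (f u ∧ not (g u))))

count≤n : (f : Fin n → Bool) → count f ≤ n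
count≤n {n} f = ≤-trans (sum-mono-≤ (toℕ≤1 ∘ f)) (≤-reflexive (sum-ones n))
  where
  sum-ones : ∀ m → sum {m} (λ _ → 1) ≡ m
  sum-ones zero    = refl
  sum-ones (suc m) = cong suc (sum-ones m)

count≡0⇒false : (f : Fin n → Bool) → count f ≡ 0 → ∀ u → f u ≡ false
count≡0⇒false f f≡0 u with f u | sum≡0⇒≡0 (toℕ ∘ f) f≡0 u
... | false | _ = refl

count>0⇒true : (f : Fin n → Bool) → 0 < count f → ∃[ u ] f u ≡ true
count>0⇒true f f>0 with sum>0⇒>0 (toℕ ∘ f) f>0
... | u , fu>0 with f u in fu
...   | true = u , fu

count-remove : (f : Fin n → Bool) (p : Fin n) → count f ≡ toℕ (f p) + count (f ─ p)
count-remove f zero    = refl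
count-remove f (suc p) = begin
  toℕ (f zero) + count (f ∘ suc)
    ≡⟨ cong (toℕ (f zero) +_) (count-remove (f ∘ suc) p) ⟩
  toℕ (f zero) + (toℕ (f (suc p)) + count (f ∘ suc ─ p))
    ≡⟨ x∙yz≈y∙xz (toℕ (f zero)) (toℕ (f (suc p))) (count (f ∘ suc ─ p)) ⟩
  toℕ (f (suc p)) + (toℕ (f zero) + count (f ∘ suc ─ p)) ∎
  where open ≡-Reasoning

count>0 : (f : Fin n → Bool) (p : Fin n) → f p ≡ true → 0 < count f
count>0 f p fp = begin-strict
  0                           <⟨ s≤s z≤n ⟩
  1 + count (f ─ p)           ≡⟨ cong (λ b → toℕ b + count (f ─ p)) fp ⟨
  toℕ (f p) + count (f ─ p)   ≡⟨ count-remove f p ⟨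
  count f                     ∎
  where open ≤-Reasoning

count-remove₂ : (f : Fin n → Bool) → p ≢ q → count f ≡ toℕ (f p) + toℕ (f q) + count (f ─ p ─ q)
count-remove₂ {p = p} {q = q} f p≢q = begin
  count f                                             ≡⟨ count-remove f p ⟩
  toℕ (f p) + count (f ─ p)                           ≡⟨ cong (toℕ (f p) +_) (count-remove (f ─ p) q) ⟩
  toℕ (f p) + (toℕ ((f ─ p) q) + count (f ─ p ─ q))   ≡⟨ cong (λ b → toℕ (f p) + (toℕ b + count (f ─ p ─ q))) (─-other f (p≢q ∘ sym)) ⟩
  toℕ (f p) + (toℕ (f q) + count (f ─ p ─ q))         ≡⟨ +-assoc (toℕ (f p)) (toℕ (f q)) (count (f ─ p ─ q)) ⟨
  toℕ (f p) + toℕ (f q) + count (f ─ p ─ q)           ∎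
  where open ≡-Reasoning

─₂-cong : (∀ u → u ≢ p → u ≢ q → f u ≡ g u) → f ─ p ─ q ≗ g ─ p ─ q
─₂-cong {p = p} {q = q} agree u with u ≟ q
... | yes _   = refl
... | no u≢q with u ≟ p
...   | yes _   = refl
...   | no u≢p  = agree u u≢p u≢q

module _ {f g : Fin n → Bool} {p q : Fin n} (p≢q : p ≢ q) (agree : ∀ u → u ≢ p → u ≢ q → f u ≡ g u) where

  private
    rest : count (f ─ p ─ q) ≡ count (g ─ p ─ q)
    rest = count-cong (─₂-cong agree)

  count-≡-off₂ : toℕ (f p) + toℕ (f q) ≡ toℕ (g p) + toℕ (g q) → count f ≡ count g
  count-≡-off₂ eq = begin
    count f                                     ≡⟨ count-remove₂ f p≢q ⟩
    toℕ (f p) + toℕ (f q) + count (f ─ p ─ q)   ≡⟨ cong₂ _+_ eq rest ⟩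
    toℕ (g p) + toℕ (g q) + count (g ─ p ─ q)   ≡⟨ count-remove₂ g p≢q ⟨
    count g                                     ∎
    where open ≡-Reasoning

  count-≤-off₂ : toℕ (f p) + toℕ (f q) ≤ toℕ (g p) + toℕ (g q) → count f ≤ count g
  count-≤-off₂ le = begin
    count f                                     ≡⟨ count-remove₂ f p≢q ⟩
    toℕ (f p) + toℕ (f q) + count (f ─ p ─ q)   ≤⟨ +-mono-≤ le (≤-reflexive rest) ⟩
    toℕ (g p) + toℕ (g q) + count (g ─ p ─ q)   ≡⟨ count-remove₂ g p≢q ⟨
    count g                                     ∎
    where open ≤-Reasoning

  count-<-off₂ : toℕ (f p) + toℕ (f q) < toℕ (g p) + toℕ (g q) → count f < count g
  count-<-off₂ lt = begin-strict
    count f                                     ≡⟨ count-remove₂ f p≢q ⟩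
    toℕ (f p) + toℕ (f q) + count (f ─ p ─ q)   <⟨ +-mono-<-≤ lt (≤-reflexive rest) ⟩
    toℕ (g p) + toℕ (g q) + count (g ─ p ─ q)   ≡⟨ count-remove₂ g p≢q ⟨
    count g                                     ∎
    where open ≤-Reasoning

record Exchanged (f g : Fin n → Bool) (p q : Fin n) : Set where
  field
    distinct  : p ≢ q
    elsewhere : ∀ u → u ≢ p → u ≢ q → g u ≡ f u
    at-p      : g p ≡ f q
    at-q      : g q ≡ f p

module _ {f g : Fin n → Bool} {p q : Fin n} (e : Exchanged f g p q) where
  open Exchanged e

  count-∧-exchanged : (h : Fin n → Bool) → h p ≡ h q → count (λ u → h u ∧ g u) ≡ count (λ u → h u ∧ f u)
  count-∧-exchanged h hp≡hq = count-≡-off₂ distinct (λ u u≢p u≢q → cong (h u ∧_) (elsewhere u u≢p u≢q)) values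
    where
    values : toℕ (h p ∧ g p) + toℕ (h q ∧ g q) ≡ toℕ (h p ∧ f p) + toℕ (h q ∧ f q)
    values rewrite at-p | at-q | hp≡hq = +-comm (toℕ (h q ∧ f q)) (toℕ (h q ∧ f p))

  module _ (fp : f p ≡ true) (fq : f q ≡ false) (l : Fin n → Bool) where

    private
      agree : ∀ u → u ≢ p → u ≢ q → (l u xor g u) ≡ (l u xor f u)
      agree u u≢p u≢q = cong (l u xor_) (elsewhere u u≢p u≢q)

    count-xor-exchanged-≤ : l p ≡ false ⊎ l q ≡ true → count (λ u → l u xor g u) ≤ count (λ u → l u xor f u)
    count-xor-exchanged-≤ (inj₁ lp) = count-≤-off₂ distinct agree values
      where
      values : toℕ (l p xor g p) + toℕ (l q xor g q) ≤ toℕ (l p xor f p) + toℕ (l q xor f q)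
      values rewrite at-p | at-q | fp | fq | lp = ≤-trans (toℕ≤1 (l q xor true)) (m≤m+n 1 _)
    count-xor-exchanged-≤ (inj₂ lq) = count-≤-off₂ distinct agree values
      where
      values : toℕ (l p xor g p) + toℕ (l q xor g q) ≤ toℕ (l p xor f p) + toℕ (l q xor f q)
      values rewrite at-p | at-q | fp | fq | lq = ≤-trans (≤-reflexive (+-identityʳ _)) (≤-trans (toℕ≤1 (l p xor false)) (m≤n+m 1 _))

    count-xor-exchanged-< : l p ≡ false → l q ≡ true → count (λ u → l u xor g u) < count (λ u → l u xor f u)
    count-xor-exchanged-< lp lq = count-<-off₂ distinct agree values
      where
      values : toℕ (l p xor g p) + toℕ (l q xor g q) < toℕ (l p xor f p) + toℕ (l q xor f q)
      values rewrite at-p | at-q | fp | fq | lp | lq = s≤s z≤n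

count-relocate : f q ≡ false → (f p ≡ true → g q ≡ true) → (∀ u → u ≢ p → f u ≡ true → g u ≡ true) →
                 ∀ a → a ≢ q → f a ≡ false → g a ≡ true → count f < count g
count-relocate {f = f} {q = q} {p = p} {g = g} fq fp⇒gq moved a a≢q fa ga = begin-strict
  count f                     ≡⟨ count-remove f p ⟩
  toℕ (f p) + count (f ─ p)   <⟨ +-mono-≤-< (toℕ-mono fp⇒gq) (count-⊂ f─p⊆g─q a f─p-a (trans (─-other g a≢q) ga)) ⟩
  toℕ (g q) + count (g ─ q)   ≡⟨ count-remove g q ⟨
  count g                     ∎
  where
  open ≤-Reasoning
  f─p-a : (f ─ p) a ≡ false
  f─p-a with a ≟ p
  ... | yes _ = refl
  ... | no _  = fa
  f─p⊆g─q : f ─ p ⊆ g ─ q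
  f─p⊆g─q u fu with u ≟ p | u ≟ q
  ... | no u≢p | yes refl = contradiction (trans (sym fu) fq) λ ()
  ... | no u≢p | no _     = moved u u≢p fu

-- Graphs and unordered pairs

adj-true⇒≢ : (K : Graph n) → adj K x y ≡ true → x ≢ y
adj-true⇒≢ K Kxy refl = contradiction (trans (sym Kxy) (irrefl K _)) λ ()

adj-sym : (K : Graph n) {c : Bool} → adj K x y ≡ c → adj K y x ≡ c
adj-sym {x = x} {y = y} K Kxy = trans (Graph.sym K y x) Kxy

deg≡count : (K : Graph n) (v : Fin n) → deg K v ≡ count (adj K v)
deg≡count K v = trans (cong List.sum (map-tabulate id (toℕ ∘ adj K v))) (sum-tabulate (toℕ ∘ adj K v))

samePair-refl : (a b : Fin n) → samePair a b a b ≡ true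
samePair-refl a b with a ≟ a | b ≟ b
... | yes _ | yes _  = refl
... | no a≢a | _     = contradiction refl a≢a
... | yes _ | no b≢b = contradiction refl b≢b

samePair-comm : (a b x y : Fin n) → samePair a b x y ≡ samePair b a x y
samePair-comm a b x y = ∨-comm (⌊ x ≟ a ⌋ ∧ ⌊ y ≟ b ⌋) (⌊ x ≟ b ⌋ ∧ ⌊ y ≟ a ⌋)

samePair-swap : (a b x y : Fin n) → samePair a b x y ≡ samePair a b y x
samePair-swap a b x y = trans (∨-comm (⌊ x ≟ a ⌋ ∧ ⌊ y ≟ b ⌋) (⌊ x ≟ b ⌋ ∧ ⌊ y ≟ a ⌋))
                              (cong₂ _∨_ (∧-comm ⌊ x ≟ b ⌋ ⌊ y ≟ a ⌋) (∧-comm ⌊ x ≟ a ⌋ ⌊ y ≟ b ⌋))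

samePair-diag : (x : Fin n) → a ≢ b → samePair a b x x ≡ false
samePair-diag {a = a} {b = b} x a≢b with x ≟ a | x ≟ b
... | yes refl | yes refl = contradiction refl a≢b
... | yes _    | no _     = refl
... | no _     | yes _    = refl
... | no _     | no _     = refl

samePair-true⇒ : (a b x y : Fin n) → samePair a b x y ≡ true → (x ≡ a × y ≡ b) ⊎ (x ≡ b × y ≡ a)
samePair-true⇒ a b x y same =
  Sum.map (witnesses (x ≟ a) (y ≟ b)) (witnesses (x ≟ b) (y ≟ a))
          (Equivalence.to (T-∨ {⌊ x ≟ a ⌋ ∧ ⌊ y ≟ b ⌋}) (Equivalence.from T-≡ same))
  where
  witnesses : ∀ {P Q : Set} (P? : Dec P) (Q? : Dec Q) → T (⌊ P? ⌋ ∧ ⌊ Q? ⌋) → P × Q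
  witnesses P? Q? = Product.map toWitness toWitness ∘ Equivalence.to (T-∧ {⌊ P? ⌋})

samePair-false : ∀ {a b x y : Fin n} → (x ≢ a ⊎ y ≢ b) → (x ≢ b ⊎ y ≢ a) → samePair a b x y ≡ false
samePair-false x≢a⊎y≢b x≢b⊎y≢a = ¬-not λ same → Sum.[ refute x≢a⊎y≢b , refute x≢b⊎y≢a ]′ (samePair-true⇒ _ _ _ _ same)
  where
  refute : ∀ {P Q : Set} → (¬ P ⊎ ¬ Q) → ¬ (P × Q)
  refute (inj₁ ¬P) (p , _) = ¬P p
  refute (inj₂ ¬Q) (_ , q) = ¬Q q

neighbour≢nonNeighbour : (K : Graph n) {z : Fin n} → adj K x y ≡ true → adj K x z ≡ false → y ≢ z
neighbour≢nonNeighbour K Kxy Kxz refl = contradiction (trans (sym Kxy) Kxz) λ ()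

adj-samePair : (K : Graph n) → samePair a b x y ≡ true → adj K x y ≡ adj K a b
adj-samePair {a = a} {b = b} {x = x} {y = y} K same with samePair-true⇒ a b x y same
... | inj₁ (refl , refl) = refl
... | inj₂ (refl , refl) = Graph.sym K b a

infix 4 _≈_

_≈_ : Graph n → Graph n → Set
H ≈ G = ∀ x y → adj H x y ≡ adj G x y

deg-cong : (H G : Graph n) → H ≈ G → ∀ v → deg H v ≡ deg G v
deg-cong H G H≈G v = trans (deg≡count H v) (trans (count-cong (H≈G v)) (sym (deg≡count G v)))

-- Restricted switches

module _ (K : Graph n) (v0 w0 v1 w1 : Fin n) where

  switchedAdj-outside : ∀ {x y} → samePair v0 w1 x y ≡ false → samePair v1 w0 x y ≡ false →
                        samePair v0 w0 x y ≡ false → samePair v1 w1 x y ≡ false →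
                        switchedAdj K v0 w0 v1 w1 x y ≡ adj K x y
  switchedAdj-outside p₀₁ p₁₀ p₀₀ p₁₁ rewrite p₀₁ | p₁₀ | p₀₀ | p₁₁ = refl

  switchedAdj-swapPairs : ∀ x y → switchedAdj K v0 w0 v1 w1 x y ≡ switchedAdj K v1 w1 v0 w0 x y
  switchedAdj-swapPairs x y =
    cong₂ (λ new old → if new then true else if old then false else adj K x y)
          (∨-comm (samePair v0 w1 x y) (samePair v1 w0 x y))
          (∨-comm (samePair v0 w0 x y) (samePair v1 w1 x y))

  switchedAdj-flipSides : ∀ x y → switchedAdj K v0 w0 v1 w1 x y ≡ switchedAdj K w0 v0 w1 v1 x y
  switchedAdj-flipSides x y =
    cong₂ (λ new old → if new then true else if old then false else adj K x y)
          (trans (cong₂ _∨_ (samePair-comm v0 w1 x y) (samePair-comm v1 w0 x y))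
                 (∨-comm (samePair w1 v0 x y) (samePair w0 v1 x y)))
          (cong₂ _∨_ (samePair-comm v0 w0 x y) (samePair-comm v1 w1 x y))

  switchedAdj-sym : ∀ x y → switchedAdj K v0 w0 v1 w1 x y ≡ switchedAdj K v0 w0 v1 w1 y x
  switchedAdj-sym x y
    rewrite samePair-swap v0 w1 x y | samePair-swap v1 w0 x y
          | samePair-swap v0 w0 x y | samePair-swap v1 w1 x y | Graph.sym K x y = refl

  switchedGraph : v0 ≢ w1 → v1 ≢ w0 → v0 ≢ w0 → v1 ≢ w1 → Graph n
  switchedGraph v0≢w1 v1≢w0 v0≢w0 v1≢w1 = record
    { adj    = switchedAdj K v0 w0 v1 w1
    ; sym    = switchedAdj-sym
    ; irrefl = λ x → trans (switchedAdj-outside (samePair-diag x v0≢w1) (samePair-diag x v1≢w0)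
                                                 (samePair-diag x v0≢w0) (samePair-diag x v1≢w1))
                           (irrefl K x) }

  switch : v0 ≢ w1 → v1 ≢ w0 →
           adj K v0 w0 ≡ true → adj K v1 w1 ≡ true → adj K v0 w1 ≡ false → adj K v1 w0 ≡ false →
           deg K v0 ≡ deg K v1 → deg K w0 ≡ deg K w1 → Σ (Graph n) (RestrictedSwitch K)
  switch v0≢w1 v1≢w0 e0 e1 ne0 ne1 degv degw =
    switchedGraph v0≢w1 v1≢w0 (adj-true⇒≢ K e0) (adj-true⇒≢ K e1) ,
    record { v0 = v0 ; w0 = w0 ; v1 = v1 ; w1 = w1 ; v0≢w1 = v0≢w1 ; v1≢w0 = v1≢w0
           ; e0 = e0 ; e1 = e1 ; ne0 = ne0 ; ne1 = ne1 ; degv = degv ; degw = degw ; result = λ _ _ → refl }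

module _ {K K' : Graph n} where

  swapPairs : RestrictedSwitch K K' → RestrictedSwitch K K'
  swapPairs s = record
    { v0 = v1 ; w0 = w1 ; v1 = v0 ; w1 = w0 ; v0≢w1 = v1≢w0 ; v1≢w0 = v0≢w1
    ; e0 = e1 ; e1 = e0 ; ne0 = ne1 ; ne1 = ne0 ; degv = sym degv ; degw = sym degw
    ; result = λ x y → trans (result x y) (switchedAdj-swapPairs K v0 w0 v1 w1 x y) }
    where open RestrictedSwitch s

  flipSides : RestrictedSwitch K K' → RestrictedSwitch K K'
  flipSides s = record
    { v0 = w0 ; w0 = v0 ; v1 = w1 ; w1 = v1 ; v0≢w1 = v1≢w0 ∘ sym ; v1≢w0 = v0≢w1 ∘ sym
    ; e0 = adj-sym K e0 ; e1 = adj-sym K e1 ; ne0 = adj-sym K ne1 ; ne1 = adj-sym K ne0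
    ; degv = degw ; degw = degv
    ; result = λ x y → trans (result x y) (switchedAdj-flipSides K v0 w0 v1 w1 x y) }
    where open RestrictedSwitch s

  module _ (s : RestrictedSwitch K K') where
    open RestrictedSwitch s

    v0≢v1 : v0 ≢ v1
    v0≢v1 v0≡v1 = neighbour≢nonNeighbour K (adj-sym K e1) (adj-sym K ne0) (sym v0≡v1)

    w0≢w1 : w0 ≢ w1
    w0≢w1 = neighbour≢nonNeighbour K e0 ne0

    v0≢w0 : v0 ≢ w0
    v0≢w0 = adj-true⇒≢ K e0

    v1≢w1 : v1 ≢ w1
    v1≢w1 = adj-true⇒≢ K e1

    -- The rows of v1, w0 and w1 are the first rows of swapPairs s, flipSides s and
    -- flipSides (swapPairs s).
    firstRow : Exchanged (adj K v0) (adj K' v0) w0 w1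
    firstRow = record
      { distinct  = w0≢w1
      ; elsewhere = λ u u≢w0 u≢w1 → trans (result v0 u)
          (switchedAdj-outside K v0 w0 v1 w1 (samePair-false (inj₂ u≢w1) (inj₁ v0≢w1))
                                             (samePair-false (inj₁ v0≢v1) (inj₁ v0≢w0))
                                             (samePair-false (inj₂ u≢w0) (inj₁ v0≢w0))
                                             (samePair-false (inj₁ v0≢v1) (inj₁ v0≢w1)))
      ; at-p = at-w0
      ; at-q = at-w1 }
      where
      at-w0 : adj K' v0 w0 ≡ adj K v0 w1
      at-w0 rewrite result v0 w0 | samePair-false {a = v0} {b = w1} {x = v0} {y = w0} (inj₂ w0≢w1) (inj₁ v0≢w1)
                  | samePair-false {a = v1} {b = w0} {x = v0} {y = w0} (inj₁ v0≢v1) (inj₁ v0≢w0)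
                  | samePair-refl v0 w0 = sym ne0
      at-w1 : adj K' v0 w1 ≡ adj K v0 w0
      at-w1 rewrite result v0 w1 | samePair-refl v0 w1 = sym e0

    outsideRows : ∀ {x} → x ≢ v0 → x ≢ v1 → x ≢ w0 → x ≢ w1 → ∀ y → adj K' x y ≡ adj K x y
    outsideRows x≢v0 x≢v1 x≢w0 x≢w1 y = trans (result _ y)
      (switchedAdj-outside K v0 w0 v1 w1 (samePair-false (inj₁ x≢v0) (inj₁ x≢w1))
                                         (samePair-false (inj₁ x≢v1) (inj₁ x≢w0))
                                         (samePair-false (inj₁ x≢v0) (inj₁ x≢w0))
                                         (samePair-false (inj₁ x≢v1) (inj₁ x≢w1)))

module _ {K K' : Graph n} (s : RestrictedSwitch K K') where
  open RestrictedSwitch s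

  switch-preserves-count : (h : Fin n → Bool) → h v0 ≡ h v1 → h w0 ≡ h w1 → ∀ x →
                           count (λ u → h u ∧ adj K' x u) ≡ count (λ u → h u ∧ adj K x u)
  switch-preserves-count h hv hw x with x ≟ v0 | x ≟ v1 | x ≟ w0 | x ≟ w1
  ... | yes refl | _        | _        | _        = count-∧-exchanged (firstRow s) h hw
  ... | no _     | yes refl | _        | _        = count-∧-exchanged (firstRow (swapPairs s)) h (sym hw)
  ... | no _     | no _     | yes refl | _        = count-∧-exchanged (firstRow (flipSides s)) h hv
  ... | no _     | no _     | no _     | yes refl = count-∧-exchanged (firstRow (flipSides (swapPairs s))) h (sym hv)
  ... | no x≢v0  | no x≢v1  | no x≢w0  | no x≢w1  =
    count-cong (λ u → cong (h u ∧_) (outsideRows s x≢v0 x≢v1 x≢w0 x≢w1 u))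

  switch-preserves-deg : ∀ x → deg K' x ≡ deg K x
  switch-preserves-deg x = begin
    deg K' x          ≡⟨ deg≡count K' x ⟩
    count (adj K' x)  ≡⟨ switch-preserves-count (λ _ → true) refl refl x ⟩
    count (adj K x)   ≡⟨ deg≡count K x ⟨
    deg K x           ∎
    where open ≡-Reasoning

  switch-inverse : {L : Graph n} → L ≈ K' → RestrictedSwitch L K
  switch-inverse {L} L≈K' = record
    { v0 = v0 ; w0 = w1 ; v1 = v1 ; w1 = w0 ; v0≢w1 = v0≢w0 s ; v1≢w0 = v1≢w1 s
    ; e0 = trans (L≈K' v0 w1) (trans (at-q (firstRow s)) e0)
    ; e1 = trans (L≈K' v1 w0) (trans (at-q (firstRow (swapPairs s))) e1)
    ; ne0 = trans (L≈K' v0 w0) (trans (at-p (firstRow s)) ne0)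
    ; ne1 = trans (L≈K' v1 w1) (trans (at-p (firstRow (swapPairs s))) ne1)
    ; degv = trans (degL v0) (trans degv (sym (degL v1)))
    ; degw = trans (degL w1) (trans (sym degw) (sym (degL w0)))
    ; result = result⁻¹ }
    where
    open Exchanged
    degL : ∀ x → deg L x ≡ deg K x
    degL x = trans (deg-cong L K' L≈K' x) (switch-preserves-deg x)
    result⁻¹ : ∀ x y → adj K x y ≡ switchedAdj L v0 w1 v1 w0 x y
    result⁻¹ x y with samePair v0 w0 x y in p₀₀
    ... | true = trans (adj-samePair K p₀₀) e0
    ... | false with samePair v1 w1 x y in p₁₁
    ...   | true = trans (adj-samePair K p₁₁) e1
    ...   | false with samePair v0 w1 x y in p₀₁
    ...     | true = trans (adj-samePair K p₀₁) ne0
    ...     | false with samePair v1 w0 x y in p₁₀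
    ...       | true  = trans (adj-samePair K p₁₀) ne1
    ...       | false = sym (trans (L≈K' x y) (trans (result x y) (switchedAdj-outside K v0 w0 v1 w1 p₀₁ p₁₀ p₀₀ p₁₁)))

-- Distance between graphs

distance : Graph n → Graph n → ℕ
distance A B = sum (λ x → count (λ y → adj A x y xor adj B x y))

distance-sym : (A B : Graph n) → distance A B ≡ distance B A
distance-sym A B = sum-cong-≗ (λ x → count-cong (λ y → xor-comm (adj A x y) (adj B x y)))

distance≡0⇒≈ : (A B : Graph n) → distance A B ≡ 0 → A ≈ B
distance≡0⇒≈ A B d≡0 x y =
  xor≡false⇒≡ (count≡0⇒false _ (sum≡0⇒≡0 (λ x → count (λ y → adj A x y xor adj B x y)) d≡0 x) y)
  where
  xor≡false⇒≡ : ∀ {b c} → b xor c ≡ false → b ≡ c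
  xor≡false⇒≡ {false} {false} _ = refl
  xor≡false⇒≡ {true}  {true}  _ = refl

switch-decreases-distance : {K K' : Graph n} (s : RestrictedSwitch K K') (L : Graph n) → let open RestrictedSwitch s in
  adj L v0 w0 ≡ false → adj L v0 w1 ≡ true → adj L v1 w1 ≡ false ⊎ adj L v1 w0 ≡ true →
  distance L K' < distance L K
switch-decreases-distance {K = K} {K' = K'} s L L₀₀ L₀₁ L₁ = sum-mono-< rowwise v0 firstRow<
  where
  open RestrictedSwitch s
  firstRow< : count (λ y → adj L v0 y xor adj K' v0 y) < count (λ y → adj L v0 y xor adj K v0 y)
  firstRow< = count-xor-exchanged-< (firstRow s) e0 ne0 (adj L v0) L₀₀ L₀₁
  -- In each other changed row, at least one of the two changed entries comes to agree with L.
  rowwise : ∀ x → count (λ y → adj L x y xor adj K' x y) ≤ count (λ y → adj L x y xor adj K x y)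
  rowwise x with x ≟ v0 | x ≟ v1 | x ≟ w0 | x ≟ w1
  ... | yes refl | _        | _        | _        = <⇒≤ firstRow<
  ... | no _     | yes refl | _        | _        =
    count-xor-exchanged-≤ (firstRow (swapPairs s)) e1 ne1 (adj L v1) L₁
  ... | no _     | no _     | yes refl | _        =
    count-xor-exchanged-≤ (firstRow (flipSides s)) (adj-sym K e0) (adj-sym K ne1) (adj L w0) (inj₁ (adj-sym L L₀₀))
  ... | no _     | no _     | no _     | yes refl =
    count-xor-exchanged-≤ (firstRow (flipSides (swapPairs s))) (adj-sym K e1) (adj-sym K ne0) (adj L w1) (inj₂ (adj-sym L L₀₁))
  ... | no x≢v0  | no x≢v1  | no x≢w0  | no x≢w1  =
    ≤-reflexive (count-cong (λ y → cong (adj L x y xor_) (outsideRows s x≢v0 x≢v1 x≢w0 x≢w1 y)))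

reachable-snoc : {H G G' : Graph n} → Reachable H G' → RestrictedSwitch G G' → Reachable H G
reachable-snoc (done H≈G')  s = step (switch-inverse s H≈G') (done λ _ _ → refl)
reachable-snoc (step t H'↝G') s = step t (reachable-snoc H'↝G' s)

-- Degree profiles and the search for a closer switch

module _ {n : ℕ} (d : Fin n → ℕ) where

  private variable
    H H' G G' : Graph n
    c : ℕ

  ofDegree : ℕ → Fin n → Bool
  ofDegree c u = d u ≡ᵇ c

  ofDegree⇒ : ∀ {c u} → ofDegree c u ≡ true → d u ≡ c
  ofDegree⇒ is = ≡ᵇ⇒≡ _ _ (Equivalence.from T-≡ is)

  ⇒ofDegree : ∀ {c u} → d u ≡ c → ofDegree c u ≡ true
  ⇒ofDegree du≡c = Equivalence.to T-≡ (≡⇒≡ᵇ _ _ du≡c)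

  classCount : Graph n → Fin n → ℕ → ℕ
  classCount K v c = count (λ u → ofDegree c u ∧ adj K v u)

  record SameProfile (H G : Graph n) : Set where
    field
      degH       : ∀ v → deg H v ≡ d v
      degG       : ∀ v → deg G v ≡ d v
      classCount≡ : ∀ v c → classCount H v c ≡ classCount G v c

  -- Opaque so that the implicit arguments of the lemmas about it are found by unification.
  opaque
    missing : Graph n → Graph n → Fin n → ℕ → Fin n → Bool
    missing H G v c u = (ofDegree c u ∧ adj G v u) ∧ not (adj H v u)

    missing⇒ : ∀ {H G v c u} → missing H G v c u ≡ true → d u ≡ c × adj G v u ≡ true × adj H v u ≡ false
    missing⇒ {H} {G} {v} {c} {u} is with ofDegree c u in du | adj G v u | adj H v u
    ... | true | true | false = ofDegree⇒ du , refl , refl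

    ⇒missing : ∀ {H G v c u} → d u ≡ c → adj G v u ≡ true → adj H v u ≡ false → missing H G v c u ≡ true
    ⇒missing du≡c Gvu Hvu rewrite ⇒ofDegree du≡c | Gvu | Hvu = refl

    missing-absent : ∀ {H G v c u} → adj G v u ≡ false → missing H G v c u ≡ false
    missing-absent {c = c} {u = u} Gvu rewrite Gvu | ∧-zeroʳ (ofDegree c u) = refl

    missing-at : ∀ {H G v c u} → d u ≡ c → adj H v u ≡ false → missing H G v c u ≡ adj G v u
    missing-at {G = G} {v = v} {u = u} du≡c Hvu rewrite ⇒ofDegree du≡c | Hvu = ∧-identityʳ (adj G v u)

    missing-balanced : SameProfile H G → ∀ v c → count (missing H G v c) ≡ count (missing G H v c)
    missing-balanced {H} {G} P v c = +-cancelˡ-≡ (count both) _ _ (begin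
      count both + count (missing H G v c)                                 ≡⟨ count-split (λ u → ofDegree c u ∧ adj G v u) (adj H v) ⟨
      classCount G v c                                                     ≡⟨ SameProfile.classCount≡ P v c ⟨
      classCount H v c                                                     ≡⟨ count-split (λ u → ofDegree c u ∧ adj H v u) (adj G v) ⟩
      count (λ u → (ofDegree c u ∧ adj H v u) ∧ adj G v u) + count (missing G H v c)
                                                                           ≡⟨ cong (_+ count (missing G H v c)) (count-cong λ u → xy∙z≈xz∙y (ofDegree c u) (adj H v u) (adj G v u)) ⟩
      count both + count (missing G H v c)                                 ∎)
      where
      open ≡-Reasoning
      both : Fin n → Bool
      both u = (ofDegree c u ∧ adj G v u) ∧ adj H v u

  private
    sameClass : ∀ K {a b} → (∀ v → deg K v ≡ d v) → deg K a ≡ deg K b → ∀ c → ofDegree c a ≡ ofDegree c b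
    sameClass K degK Ka≡Kb c = cong (_≡ᵇ c) (trans (sym (degK _)) (trans Ka≡Kb (degK _)))

  SameProfile-switchˡ : SameProfile H G → RestrictedSwitch H H' → SameProfile H' G
  SameProfile-switchˡ {H = H} P s = record
    { degH        = λ v → trans (switch-preserves-deg s v) (degH v)
    ; degG        = degG
    ; classCount≡ = λ v c → trans (switch-preserves-count s (ofDegree c) (sameClass H degH degv c) (sameClass H degH degw c) v)
                                  (classCount≡ v c) }
    where
    open SameProfile P
    open RestrictedSwitch s

  SameProfile-switchʳ : SameProfile H G → RestrictedSwitch G G' → SameProfile H G'
  SameProfile-switchʳ {G = G} P s = record
    { degH        = degH
    ; degG        = λ v → trans (switch-preserves-deg s v) (degG v)
    ; classCount≡ = λ v c → trans (classCount≡ v c)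
                                  (sym (switch-preserves-count s (ofDegree c) (sameClass G degG degv c) (sameClass G degG degw c) v)) }
    where
    open SameProfile P
    open RestrictedSwitch s

  data Progress (H G : Graph n) : Set where
    switchˡ : ∀ {H'} → RestrictedSwitch H H' → distance H' G < distance H G → Progress H G
    switchʳ : ∀ {G'} → RestrictedSwitch G G' → distance H G' < distance H G → Progress H G

  module _ {H G : Graph n} (P : SameProfile H G) (c : ℕ) where
    open SameProfile P

    alternatingPath : ∀ x → 0 < count (missing H G x c) →
                      ∃₂ λ a b → missing G H x c a ≡ true × missing H G a (d x) b ≡ true
    alternatingPath x x↝ with count>0⇒true (missing G H x c) (subst (0 <_) (missing-balanced P x c) x↝)
    ... | a , xa with missing⇒ xa
    ...   | _ , Hxa , Gxa with count>0⇒true (missing H G a (d x))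
                                 (subst (0 <_) (sym (missing-balanced P a (d x)))
                                        (count>0 _ x (⇒missing refl (adj-sym H Hxa) (adj-sym G Gxa))))
    ...     | b , ab = a , b , xa , ab

    module _ {x a b : Fin n} (xa : missing G H x c a ≡ true) (ab : missing H G a (d x) b ≡ true) where
      private
        da : d a ≡ c
        da = proj₁ (missing⇒ xa)
        Hxa : adj H x a ≡ true
        Hxa = proj₁ (proj₂ (missing⇒ xa))
        Gxa : adj G x a ≡ false
        Gxa = proj₂ (proj₂ (missing⇒ xa))
        db : d b ≡ d x
        db = proj₁ (missing⇒ ab)
        Gab : adj G a b ≡ true
        Gab = proj₁ (proj₂ (missing⇒ ab))
        Hab : adj H a b ≡ false
        Hab = proj₂ (proj₂ (missing⇒ ab))

      -- If bz ∈ H, switch ax, zb to ab, zx in H; otherwise bz ∉ G, and switch ab, zx to ax, zb in G.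

      closeCycle : ∀ z → missing H G x c z ≡ true → z ≢ b → missing H G b c z ≡ false → Progress H G
      closeCycle z xz z≢b ¬bz with missing⇒ xz | adj H b z in Hbz
      ... | dz , Gxz , Hxz | true =
        let H' , s = switch H a x z b (adj-true⇒≢ G Gab) (adj-true⇒≢ G Gxz ∘ sym)
                            (adj-sym H Hxa) (adj-sym H Hbz) Hab (adj-sym H Hxz)
                            (trans (degH a) (trans da (sym (trans (degH z) dz))))
                            (trans (degH x) (sym (trans (degH b) db)))
        in switchˡ s (subst₂ _<_ (distance-sym G H') (distance-sym G H)
                       (switch-decreases-distance s G (adj-sym G Gxa) Gab (inj₂ (adj-sym G Gxz))))
      ... | dz , Gxz , Hxz | false =
        let G' , s = switch G a b z x (adj-true⇒≢ H Hxa ∘ sym) z≢b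
                            Gab (adj-sym G Gxz) (adj-sym G Gxa) (adj-sym G Gbz)
                            (trans (degG a) (trans da (sym (trans (degG z) dz))))
                            (trans (degG b) (trans db (sym (degG x))))
        in switchʳ s (switch-decreases-distance s H Hab (adj-sym H Hxa) (inj₁ (adj-sym H Hxz)))
        where
        Gbz : adj G b z ≡ false
        Gbz = trans (sym (missing-at dz Hbz)) ¬bz

      extendPath : (∀ z → missing H G x c z ≡ true → z ≢ b → missing H G b c z ≡ true) →
                   count (missing H G x c) < count (missing H G b c)
      extendPath moved = count-relocate
        (missing-absent (irrefl G x))
        (λ xb → let db′ , Gxb , Hxb = missing⇒ xb in ⇒missing (trans (sym db) db′) (adj-sym G Gxb) (adj-sym H Hxb))
        (λ u u≢b xu → moved u xu u≢b)
        a (adj-true⇒≢ H Hxa ∘ sym) (missing-absent Gxa) (⇒missing da (adj-sym G Gab) (adj-sym H Hab))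

      closeOrExtend : Progress H G ⊎ count (missing H G x c) < count (missing H G b c)
      closeOrExtend with any? (λ z → (missing H G x c z ≟ᵇ true) ×-dec (¬? (z ≟ b) ×-dec (missing H G b c z ≟ᵇ false)))
      ... | yes (z , xz , z≢b , ¬bz) = inj₁ (closeCycle z xz z≢b ¬bz)
      ... | no none = inj₂ (extendPath moved)
        where
        moved : ∀ z → missing H G x c z ≡ true → z ≢ b → missing H G b c z ≡ true
        moved z xz z≢b = ¬-not λ ¬bz → none (z , xz , z≢b , ¬bz)

    search : ∀ x → 0 < count (missing H G x c) → Acc _<_ (n ∸ count (missing H G x c)) → Progress H G
    search x x↝ (acc rec) with alternatingPath x x↝
    ... | a , b , xa , ab with closeOrExtend xa ab
    ...   | inj₁ closer = closer
    ...   | inj₂ grows    = search b (<-≤-trans (s≤s z≤n) grows) (rec (∸-monoʳ-< grows (count≤n _)))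

  disagreement⇒missing : SameProfile H G → ∀ x y → (adj H x y xor adj G x y) ≡ true → 0 < count (missing H G x (d y))
  disagreement⇒missing {H} {G} P x y differ with adj H x y in Hxy | adj G x y in Gxy
  ... | false | true = count>0 _ y (⇒missing refl Gxy Hxy)
  ... | true | false = subst (0 <_) (sym (missing-balanced P x (d y))) (count>0 _ y (⇒missing refl Hxy Gxy))

  progress : SameProfile H G → H ≈ G ⊎ Progress H G
  progress {H} {G} P with distance H G ℕ.≟ 0
  ... | yes dist≡0 = inj₁ (distance≡0⇒≈ H G dist≡0)
  ... | no dist≢0 with sum>0⇒>0 (λ x → count (λ y → adj H x y xor adj G x y)) (n≢0⇒n>0 dist≢0)
  ...   | x , x-differs with count>0⇒true _ x-differs
  ...     | y , differ = inj₂ (search P (d y) x x↝ (<-wellFounded (n ∸ count (missing H G x (d y)))))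
    where
    x↝ : 0 < count (missing H G x (d y))
    x↝ = disagreement⇒missing P x y differ

  reachable : SameProfile H G → Acc _<_ (distance H G) → Reachable H G
  reachable P (acc rec) with progress P
  ... | inj₁ H≈G                 = done H≈G
  ... | inj₂ (switchˡ s closer)  = step s (reachable (SameProfile-switchˡ P s) (rec closer))
  ... | inj₂ (switchʳ s closer)  = reachable-snoc (reachable (SameProfile-switchʳ P s) (rec closer)) s

-- Vertex types

length-filterᵇ : (f : A → Bool) (xs : List A) → length (filterᵇ f xs) ≡ List.sum (map (toℕ ∘ f) xs)
length-filterᵇ f []       = refl
length-filterᵇ f (x ∷ xs) with f x
... | true  = cong suc (length-filterᵇ f xs)
... | false = length-filterᵇ f xs

sum-filterᵇ : (f h : A → Bool) (xs : List A) →
              List.sum (map (toℕ ∘ h) (filterᵇ f xs)) ≡ List.sum (map (λ u → toℕ (h u ∧ f u)) xs)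
sum-filterᵇ f h []       = refl
sum-filterᵇ f h (x ∷ xs) with f x
... | true  = cong₂ _+_ (cong toℕ (sym (∧-identityʳ (h x)))) (sum-filterᵇ f h xs)
... | false = cong₂ _+_ (cong toℕ (sym (∧-zeroʳ (h x)))) (sum-filterᵇ f h xs)

sortDesc-↭ : (xs : List ℕ) → sortDesc xs ↭ xs
sortDesc-↭ = SortingAlgorithm.sort-↭ (MergeSort.mergeSort (Flip.decTotalOrder ≤-decTotalOrder))

occurrences : ℕ → List ℕ → ℕ
occurrences c = List.sum ∘ map (toℕ ∘ (_≡ᵇ c))

length-vertexType : (K : Graph n) (v : Fin n) → length (vertexType K v) ≡ deg K v
length-vertexType K v = begin
  length (sortDesc (map (deg K) (neighbours K v)))   ≡⟨ ↭-length (sortDesc-↭ (map (deg K) (neighbours K v))) ⟩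
  length (map (deg K) (neighbours K v))              ≡⟨ length-map (deg K) (neighbours K v) ⟩
  length (neighbours K v)                            ≡⟨ length-filterᵇ (adj K v) (allFin _) ⟩
  deg K v                                            ∎
  where open ≡-Reasoning

occurrences-vertexType : (d : Fin n → ℕ) (K : Graph n) → (∀ u → deg K u ≡ d u) →
                         ∀ v c → occurrences c (vertexType K v) ≡ classCount d K v c
occurrences-vertexType {n} d K degK v c = begin
  occurrences c (sortDesc (map (deg K) (neighbours K v)))    ≡⟨ sum-↭ (map⁺ (toℕ ∘ (_≡ᵇ c)) (sortDesc-↭ (map (deg K) (neighbours K v)))) ⟩
  occurrences c (map (deg K) (neighbours K v))               ≡⟨ cong (occurrences c) (map-cong degK (neighbours K v)) ⟩
  occurrences c (map d (neighbours K v))                     ≡⟨ cong List.sum (map-∘ (neighbours K v)) ⟨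
  List.sum (map (toℕ ∘ ofDegree d c) (neighbours K v))       ≡⟨ sum-filterᵇ (adj K v) (ofDegree d c) (allFin n) ⟩
  List.sum (map classIndicator (allFin n))                   ≡⟨ cong List.sum (map-tabulate id classIndicator) ⟩
  List.sum (tabulate classIndicator)                         ≡⟨ sum-tabulate classIndicator ⟩
  classCount d K v c                                         ∎
  where
  open ≡-Reasoning
  classIndicator : Fin n → ℕ
  classIndicator u = toℕ (ofDegree d c u ∧ adj K v u)

vertexTypes⇒SameProfile : (G H : Graph n) → (∀ v → vertexType G v ≡ vertexType H v) → SameProfile (deg G) H G
vertexTypes⇒SameProfile G H sameType = record
  { degH        = degH
  ; degG        = λ _ → refl
  ; classCount≡ = λ v c → begin
      classCount (deg G) H v c       ≡⟨ occurrences-vertexType (deg G) H degH v c ⟨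
      occurrences c (vertexType H v) ≡⟨ cong (occurrences c) (sameType v) ⟨
      occurrences c (vertexType G v) ≡⟨ occurrences-vertexType (deg G) G (λ _ → refl) v c ⟩
      classCount (deg G) G v c       ∎ }
  where
  open ≡-Reasoning
  degH : ∀ v → deg H v ≡ deg G v
  degH v = begin
    deg H v                   ≡⟨ length-vertexType H v ⟨
    length (vertexType H v)   ≡⟨ cong length (sameType v) ⟨
    length (vertexType G v)   ≡⟨ length-vertexType G v ⟩
    deg G v                   ∎

theorem4 : (n : ℕ) (G H : Graph n) →
    (∀ v → vertexType G v ≡ vertexType H v) →
    Reachable H G
theorem4 n G H sameType = reachable (deg G) (vertexTypes⇒SameProfile G H sameType) (<-wellFounded _)
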